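{- Let $1/n\ll\alpha_2\ll\alpha_1\ll\eta\ll1$. Let $G$ be an $n$-vertex oriented graph with $\sigma_2(G)\ge(1+\eta)n$. Then every vertex $v\in V(G)$ is either $\alpha_1$-strongly absorbable or $(\alpha_2,\alpha_1)$-weakly absorbable.
   Context: An oriented graph is a loopless digraph with at most one edge between any two vertices; $U(G)$ is its underlying undirected graph; $d(x)$ is the total degree; vertices are non-adjacent if no edge joins them in either direction; $\sigma_2(G)=\min\{d(x)+d(y):x,y\text{ non-adjacent}\}$. A strong absorber of a pair of vertices $\{u,v\}$ (not necessarily distinct) is a set of two vertices $a,b$ with $ab,au,bv\in E(U(G))$; $\{u,v\}$ is $\alpha_1$-strongly absorbable if it has at least $\alpha_1n^2$ strong absorbers; a vertex $v$ is $\alpha_1$-strongly absorbable if the pair $\{v,v\}$ is. An $\alpha_1$-weak absorber of a pair $\{u,v\}$ (not necessarily distinct) is a set of four vertices $a,a',b',b$ with $aa',au,vb,b'b\in E(U(G))$ such that $\{a',b'\}$ is $\alpha_1$-strongly absorbable; a vertex $u$ is $(\alpha_2,\alpha_1)$-weakly absorbable if $\{u,u\}$ has at least $\alpha_2n^4$ $\alpha_1$-weak absorbers. Hierarchy convention: "$a\ll b$" means the statement holds whenever $a\le f(b)$ for some non-decreasing function $f$; constants are chosen from right to left.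
   Formalization: The constants η, α₁ and α₂ in the hierarchy range over the positive rationals. -}

module Defs where

open import Data.Bool using (Bool; true; false; _∧_; _∨_; not; T)
open import Data.Nat as ℕ using (ℕ; zero; suc; _<ᵇ_)
open import Data.Fin using (Fin; toℕ; _≟_)
open import Data.List using (List; []; _∷_; allFin)
open import Data.Integer using (+_)
open import Data.Rational using (ℚ; _/_; _*_; _+_; _≤_; _≤ᵇ_; 1ℚ)
open import Relation.Nullary.Decidable using (⌊_⌋)
open import Relation.Binary.PropositionalEquality using (_≡_)

-- An oriented graph on vertex set Fin n: a loopless digraph with at most one
-- edge between any two vertices. E x y = true means x → y is an edge.
record OrientedGraph (n : ℕ) : Set where
  field
    E        : Fin n → Fin n → Bool
    loopless : ∀ x → E x x ≡ false
    oriented : ∀ x y → E x y ≡ true → E y x ≡ false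
open OrientedGraph public

ℕ→ℚ : ℕ → ℚ
ℕ→ℚ k = (+ k) / 1

countB : {A : Set} → (A → Bool) → List A → ℕ
countB p [] = 0
countB p (x ∷ xs) with p x
... | true  = suc (countB p xs)
... | false = countB p xs

sumL : {A : Set} → (A → ℕ) → List A → ℕ
sumL f [] = 0
sumL f (x ∷ xs) = f x ℕ.+ sumL f xs

anyB : {A : Set} → (A → Bool) → List A → Bool
anyB p [] = false
anyB p (x ∷ xs) = p x ∨ anyB p xs

module _ {n : ℕ} (G : OrientedGraph n) where

  adj : Fin n → Fin n → Bool
  adj x y = E G x y ∨ E G y x

  eqB : Fin n → Fin n → Bool
  eqB x y = ⌊ x ≟ y ⌋

  ltB : Fin n → Fin n → Bool
  ltB x y = toℕ x <ᵇ toℕ y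

  deg : Fin n → ℕ
  deg x = countB (adj x) (allFin n)

  strongLabel : Fin n → Fin n → Fin n → Fin n → Bool
  strongLabel u v a b = adj a b ∧ adj a u ∧ adj b v

  -- number of strong absorbers of {u , v}: two-element sets {p , q}
  -- (listed as p < q) admitting a labelling a , b with ab, au, bv ∈ E(U(G))
  numStrong : Fin n → Fin n → ℕ
  numStrong u v =
    sumL (λ p → countB (λ q → ltB p q ∧ (strongLabel u v p q ∨ strongLabel u v q p))
                         (allFin n))
           (allFin n)

  strongB : ℚ → Fin n → Fin n → Bool
  strongB α₁ u v = (α₁ * ℕ→ℚ (n ℕ.* n)) ≤ᵇ ℕ→ℚ (numStrong u v)

  StronglyAbsorbablePair : ℚ → Fin n → Fin n → Set
  StronglyAbsorbablePair α₁ u v = α₁ * ℕ→ℚ (n ℕ.* n) ≤ ℕ→ℚ (numStrong u v)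

  StronglyAbsorbable : ℚ → Fin n → Set
  StronglyAbsorbable α₁ v = StronglyAbsorbablePair α₁ v v

  weakLabel : ℚ → Fin n → Fin n → Fin n → Fin n → Fin n → Fin n → Bool
  weakLabel α₁ u v a a' b' b =
    adj a a' ∧ adj a u ∧ adj v b ∧ adj b' b ∧ strongB α₁ a' b'

  distinct4 : Fin n → Fin n → Fin n → Fin n → Bool
  distinct4 a b c d =
    not (eqB a b) ∧ not (eqB a c) ∧ not (eqB a d) ∧
    not (eqB b c) ∧ not (eqB b d) ∧ not (eqB c d)

  -- the four-element set {w , x , y , z} admits a labelling (a , a' , b' , b)
  -- (a bijection onto the set) forming an α₁-weak absorber of {u , v}
  weakSet : ℚ → Fin n → Fin n → Fin n → Fin n → Fin n → Fin n → Bool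
  weakSet α₁ u v w x y z =
    let L = w ∷ x ∷ y ∷ z ∷ [] in
    anyB (λ a → anyB (λ a' → anyB (λ b' → anyB (λ b →
      distinct4 a a' b' b ∧ weakLabel α₁ u v a a' b' b) L) L) L) L

  -- number of α₁-weak absorbers of {u , v}: four-element sets (listed as
  -- w < x < y < z) admitting a suitable labelling
  numWeak : ℚ → Fin n → Fin n → ℕ
  numWeak α₁ u v =
    sumL (λ w → sumL (λ x → sumL (λ y → countB (λ z →
      ltB w x ∧ ltB x y ∧ ltB y z ∧ weakSet α₁ u v w x y z)
      (allFin n)) (allFin n)) (allFin n)) (allFin n)

  WeaklyAbsorbable : ℚ → ℚ → Fin n → Set
  WeaklyAbsorbable α₂ α₁ u =
    α₂ * ℕ→ℚ (n ℕ.* n ℕ.* n ℕ.* n) ≤ ℕ→ℚ (numWeak α₁ u u)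

  -- σ₂(G) ≥ (1 + η) n : every non-adjacent pair of distinct vertices has
  -- degree sum at least (1 + η) n (vacuous if there is no such pair)
  Sigma2Geq : ℚ → Set
  Sigma2Geq η = ∀ x y → T (not (eqB x y) ∧ not (adj x y)) →
    (1ℚ + η) * ℕ→ℚ n ≤ ℕ→ℚ (deg x ℕ.+ deg y)

{-# OPTIONS --safe #-}
module Submission where

-- Every vertex is in fact weakly absorbable.  Let m be the denominator of η, so σ₂(G) ≥ (1 + 1/m) n.
-- Call x high if d(x) ≥ (1 + 1/m) n / 2 and low otherwise.  Two non-adjacent low vertices would violate
-- the degree condition, so the low vertices form a clique.  A pair {a′, b′} then has Ω(n²/m²) strong
-- absorbers if both are high (either one has n/4m high neighbours, each with n/m common neighbours with
-- the other, or both have n/4m low neighbours, which are pairwise adjacent), and also if both are low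
-- with n/4m low neighbours each.  Every vertex has degree at least n/m − 1, so for each v there is a
-- class C ∈ {high, low} such that half of the neighbours a of v have half of their neighbours in C; a
-- low neighbour of such an a has almost as many low neighbours as a, the low vertices being a clique.
-- Choosing such a, b ∈ N(v), a′ ∈ N(a) ∩ C and b′ ∈ N(b) ∩ C, all distinct, gives (n/4m)⁴ labelled
-- weak absorbers (a, a′, b′, b) of {v, v}, and a 4-set has at most 24 labellings.

module Counting where

  open import Data.Bool using (Bool; true; false; _∧_; _∨_; not; T)
  open import Data.Bool.Properties using (T?; T-∧; T-∨)
  open import Data.Empty using (⊥-elim)
  open import Data.Fin using (Fin; zero; suc; _≟_; punchIn; _<_)
  open import Data.Fin.Properties using (punchInᵢ≢i; <-cmp; _<?_)
  open import Data.Nat using (ℕ; zero; suc; _+_; _*_; _^_; _≤_; z≤n; s≤s)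
  open import Data.Nat.Properties hiding (_≟_; <-cmp; _<?_)
  open import Algebra.Properties.Semiring.Sum +-*-semiring
    using (sum-syntax; sum-cong-≗; sum-remove; ∑-comm; ∑-distrib-+; *-distribˡ-sum; *-distribʳ-sum)
  open import Data.Product using (_×_; _,_; proj₂)
  open import Data.Sum using (_⊎_; inj₁; inj₂; [_,_])
  open import Data.Unit using (tt)
  open import Function using (_∘_; id; case_of_)
  open import Function.Bundles using (Equivalence)
  open import Relation.Binary.Definitions using (tri<; tri≈; tri>)
  open import Relation.Binary.PropositionalEquality
    using (_≡_; _≢_; refl; sym; trans; cong; cong₂; subst; ≢-sym)
  open import Relation.Nullary using (¬_; Dec; yes; no; does; ¬?; _×-dec_; _⊎-dec_)
  open Equivalence using (to; from)

  𝟙 : Bool → ℕ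
  𝟙 true  = 1
  𝟙 false = 0

  𝟙≤1 : ∀ b → 𝟙 b ≤ 1
  𝟙≤1 true  = ≤-refl
  𝟙≤1 false = z≤n

  1≤𝟙 : ∀ {b} → T b → 1 ≤ 𝟙 b
  1≤𝟙 {true} _ = ≤-refl

  𝟙≤ : ∀ {b k} → (T b → 1 ≤ k) → 𝟙 b ≤ k
  𝟙≤ {false} _ = z≤n
  𝟙≤ {true}  h = h tt

  𝟙-mono : ∀ {a b} → (T a → T b) → 𝟙 a ≤ 𝟙 b
  𝟙-mono a⇒b = 𝟙≤ (1≤𝟙 ∘ a⇒b)

  𝟙*≤ : ∀ {b} {B C : ℕ} → (T b → B ≤ C) → 𝟙 b * B ≤ C
  𝟙*≤ {false} _     = z≤n
  𝟙*≤ {true} {B} h = subst (_≤ _) (sym (+-identityʳ B)) (h tt)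

  ¬T⇒T-not : ∀ {b} → ¬ T b → T (not b)
  ¬T⇒T-not {false} _  = tt
  ¬T⇒T-not {true}  ¬t = ¬t tt

  does⇒ : ∀ {A : Set} (A? : Dec A) → T (does A?) → A
  does⇒ (yes a) _ = a

  ¬does⇒ : ∀ {A : Set} (A? : Dec A) → T (not (does A?)) → ¬ A
  ¬does⇒ (no ¬a) _ = ¬a

  ⇒does : ∀ {A : Set} (A? : Dec A) → A → T (does A?)
  ⇒does (yes _) _  = tt
  ⇒does (no ¬a) a = ¬a a

  1≤does : ∀ {A : Set} (A? : Dec A) → A → 1 ≤ 𝟙 (does A?)
  1≤does A? = 1≤𝟙 ∘ ⇒does A?

  1≤+ˡ : ∀ {m n} → 1 ≤ m → 1 ≤ m + n
  1≤+ˡ {m} {n} h = ≤-trans h (m≤m+n m n)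

  1≤+ʳ : ∀ {m n} → 1 ≤ n → 1 ≤ m + n
  1≤+ʳ {m} {n} h = ≤-trans h (m≤n+m n m)

  𝟙-⊎ : ∀ {A B C : Set} (A? : Dec A) (B? : Dec B) (C? : Dec C) →
        (A → B ⊎ C) → 𝟙 (does A?) ≤ 𝟙 (does B?) + 𝟙 (does C?)
  𝟙-⊎ A? B? C? A⇒B⊎C =
    𝟙≤ λ t → [ (λ b → 1≤+ˡ (1≤does B? b)) , (λ c → 1≤+ʳ (1≤does C? c)) ] (A⇒B⊎C (does⇒ A? t))

  𝟙-⊎₃ : ∀ {A B C D : Set} (A? : Dec A) (B? : Dec B) (C? : Dec C) (D? : Dec D) →
         (A → B ⊎ C ⊎ D) → 𝟙 (does A?) ≤ 𝟙 (does B?) + (𝟙 (does C?) + 𝟙 (does D?))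
  𝟙-⊎₃ A? B? C? D? A⇒B⊎C⊎D =
    ≤-trans (𝟙-⊎ A? B? (C? ⊎-dec D?) A⇒B⊎C⊎D) (+-monoʳ-≤ (𝟙 (does B?)) (𝟙-⊎ (C? ⊎-dec D?) C? D? id))

  𝟙-⊎₄ : ∀ {A B C D E : Set} (A? : Dec A) (B? : Dec B) (C? : Dec C) (D? : Dec D) (E? : Dec E) →
         (A → B ⊎ C ⊎ D ⊎ E) → 𝟙 (does A?) ≤ 𝟙 (does B?) + (𝟙 (does C?) + (𝟙 (does D?) + 𝟙 (does E?)))
  𝟙-⊎₄ A? B? C? D? E? A⇒B⊎C⊎D⊎E =
    ≤-trans (𝟙-⊎ A? B? (C? ⊎-dec D? ⊎-dec E?) A⇒B⊎C⊎D⊎E)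
            (+-monoʳ-≤ (𝟙 (does B?)) (𝟙-⊎₃ (C? ⊎-dec D? ⊎-dec E?) C? D? E? id))

  ∑-mono-≤ : ∀ {k} {f g : Fin k → ℕ} → (∀ i → f i ≤ g i) → ∑[ i < k ] f i ≤ ∑[ i < k ] g i
  ∑-mono-≤ {zero}  _   = z≤n
  ∑-mono-≤ {suc k} f≤g = +-mono-≤ (f≤g zero) (∑-mono-≤ (f≤g ∘ suc))

  ∑-1 : ∀ k → ∑[ i < k ] 1 ≡ k
  ∑-1 zero    = refl
  ∑-1 (suc k) = cong suc (∑-1 k)

  count : ∀ {k} → (Fin k → Bool) → ℕ
  count {k} P = ∑[ i < k ] 𝟙 (P i)

  count≤ : ∀ {k} (P : Fin k → Bool) → count P ≤ k
  count≤ {k} P = ≤-trans (∑-mono-≤ (𝟙≤1 ∘ P)) (≤-reflexive (∑-1 k))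

  count-mono : ∀ {k} {P Q : Fin k → Bool} → (∀ i → T (P i) → T (Q i)) → count P ≤ count Q
  count-mono P⇒Q = ∑-mono-≤ (λ i → 𝟙-mono (P⇒Q i))

  count-∧-split : ∀ {k} (P Q : Fin k → Bool) →
                  count (λ i → P i ∧ Q i) + count (λ i → P i ∧ not (Q i)) ≡ count P
  count-∧-split P Q =
    trans (sym (∑-distrib-+ (λ i → 𝟙 (P i ∧ Q i)) (λ i → 𝟙 (P i ∧ not (Q i)))))
          (sum-cong-≗ (λ i → split (P i) (Q i)))
    where
    split : ∀ a b → 𝟙 (a ∧ b) + 𝟙 (a ∧ not b) ≡ 𝟙 a
    split true  true  = refl
    split true  false = refl
    split false _     = refl

  count-∧-≥ : ∀ {k} (P Q : Fin k → Bool) → count P + count Q ≤ count (λ i → P i ∧ Q i) + k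
  count-∧-≥ {k} P Q = begin
    count P + count Q                       ≡⟨ ∑-distrib-+ (𝟙 ∘ P) (𝟙 ∘ Q) ⟨
    ∑[ i < k ] (𝟙 (P i) + 𝟙 (Q i))          ≤⟨ ∑-mono-≤ (λ i → shared (P i) (Q i)) ⟩
    ∑[ i < k ] (𝟙 (P i ∧ Q i) + 1)          ≡⟨ ∑-distrib-+ (λ i → 𝟙 (P i ∧ Q i)) (λ _ → 1) ⟩
    count (λ i → P i ∧ Q i) + ∑[ i < k ] 1  ≡⟨ cong (count (λ i → P i ∧ Q i) +_) (∑-1 k) ⟩
    count (λ i → P i ∧ Q i) + k             ∎
    where
    open ≤-Reasoning
    shared : ∀ a b → 𝟙 a + 𝟙 b ≤ 𝟙 (a ∧ b) + 1
    shared true  true  = ≤-refl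
    shared true  false = ≤-refl
    shared false true  = ≤-refl
    shared false false = z≤n

  count-except : ∀ {k} {P Q : Fin k → Bool} (j : Fin k) →
                 (∀ i → T (P i) → i ≢ j → T (Q i)) → count P ≤ suc (count Q)
  count-except {suc k} {P} {Q} j P⇒Q = begin
    count P                                        ≡⟨ sum-remove (𝟙 ∘ P) ⟩
    𝟙 (P j) + ∑[ i < k ] 𝟙 (P (punchIn j i))       ≤⟨ +-mono-≤ (𝟙≤1 (P j)) (∑-mono-≤ λ i →
                                                       𝟙-mono λ Pi → P⇒Q _ Pi (punchInᵢ≢i j i)) ⟩
    suc (∑[ i < k ] 𝟙 (Q (punchIn j i)))           ≤⟨ s≤s (m≤n+m _ (𝟙 (Q j))) ⟩
    suc (𝟙 (Q j) + ∑[ i < k ] 𝟙 (Q (punchIn j i))) ≡⟨ cong suc (sum-remove (𝟙 ∘ Q)) ⟨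
    suc (count Q)                                  ∎
    where open ≤-Reasoning

  count-except₂ : ∀ {k} {P Q : Fin k → Bool} (j j′ : Fin k) →
                  (∀ i → T (P i) → i ≢ j → i ≢ j′ → T (Q i)) → count P ≤ count Q + 2
  count-except₂ {P = P} {Q} j j′ P⇒Q = begin
    count P             ≤⟨ count-except j (λ i Pi i≢j → T-∧ .from (Pi , ⇒does (¬? (i ≟ j)) i≢j)) ⟩
    suc (count P∖j)     ≤⟨ s≤s (count-except j′ λ i t i≢j′ →
                             let Pi , i≢j = T-∧ .to t in P⇒Q i Pi (does⇒ (¬? (i ≟ j)) i≢j) i≢j′) ⟩
    suc (suc (count Q)) ≡⟨ +-comm 2 (count Q) ⟩
    count Q + 2         ∎
    where
    open ≤-Reasoning
    P∖j = λ i → P i ∧ not (does (i ≟ j))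

  count*≤∑ : ∀ {k} (P : Fin k → Bool) (f : Fin k → ℕ) {B b : ℕ} →
             (∀ i → T (P i) → B ≤ b * f i) → count P * B ≤ b * ∑[ i < k ] f i
  count*≤∑ {k} P f {B} {b} bound = begin
    count P * B              ≡⟨ *-distribʳ-sum B (𝟙 ∘ P) ⟩
    ∑[ i < k ] (𝟙 (P i) * B) ≤⟨ ∑-mono-≤ (λ i → 𝟙*≤ (bound i)) ⟩
    ∑[ i < k ] (b * f i)     ≡⟨ *-distribˡ-sum b f ⟨
    b * ∑[ i < k ] f i       ∎
    where open ≤-Reasoning

  ∑-fibres-≥ : ∀ {k N q j} (P : Fin k → Bool) (f : Fin k → ℕ) → N ≤ q * count P →
               (∀ i → T (P i) → N ^ j ≤ q ^ j * f i) → N ^ suc j ≤ q ^ suc j * ∑[ i < k ] f i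
  ∑-fibres-≥ {k} {N} {q} {j} P f many fibre = begin
    N * N ^ j                    ≤⟨ *-monoˡ-≤ (N ^ j) many ⟩
    q * count P * N ^ j          ≡⟨ *-assoc q (count P) (N ^ j) ⟩
    q * (count P * N ^ j)        ≤⟨ *-monoʳ-≤ q (count*≤∑ P f {b = q ^ j} fibre) ⟩
    q * (q ^ j * ∑[ i < k ] f i) ≡⟨ *-assoc q (q ^ j) _ ⟨
    q * q ^ j * ∑[ i < k ] f i   ∎
    where open ≤-Reasoning

  module _ {k : ℕ} (P₁ : Fin k → Bool) (P₂ : Fin k → Fin k → Bool)
           (P₃ : Fin k → Fin k → Fin k → Bool) (P₄ : Fin k → Fin k → Fin k → Fin k → Bool) where

    count-tree-≥ : ∀ {N q} → N ≤ q * count P₁ →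
      (∀ a → T (P₁ a) → N ≤ q * count (P₂ a)) →
      (∀ a a′ → T (P₂ a a′) → N ≤ q * count (P₃ a a′)) →
      (∀ a a′ b → T (P₃ a a′ b) → N ≤ q * count (P₄ a a′ b)) →
      N ^ 4 ≤ q ^ 4 * ∑[ a < k ] ∑[ a′ < k ] ∑[ b < k ] ∑[ b′ < k ] 𝟙 (P₄ a a′ b b′)
    count-tree-≥ {q = q} many₁ many₂ many₃ many₄ =
      ∑-fibres-≥ {q = q} {j = 3} P₁ _ many₁ λ a p₁ →
      ∑-fibres-≥ {q = q} {j = 2} (P₂ a) _ (many₂ a p₁) λ a′ p₂ →
      ∑-fibres-≥ {q = q} {j = 1} (P₃ a a′) _ (many₃ a a′ p₂) λ b p₃ →
      ∑-fibres-≥ {q = q} {j = 0} (P₄ a a′ b) _ (many₄ a a′ b p₃) λ b′ p₄ →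
      ≤-trans (1≤𝟙 p₄) (m≤m+n _ 0)

  <-≢-cases : ∀ {k} {i j : Fin k} → i ≢ j → i < j ⊎ j < i
  <-≢-cases {i = i} {j} i≢j with <-cmp i j
  ... | tri< i<j _ _ = inj₁ i<j
  ... | tri≈ _ i≡j _ = ⊥-elim (i≢j i≡j)
  ... | tri> _ _ j<i = inj₂ j<i

  ordered≤2*unordered : ∀ {k} (R : Fin k → Fin k → Bool) → (∀ x → ¬ T (R x x)) →
    ∑[ x < k ] ∑[ y < k ] 𝟙 (R x y) ≤ 2 * ∑[ p < k ] ∑[ q < k ] 𝟙 (does (p <? q) ∧ (R p q ∨ R q p))
  ordered≤2*unordered {k} R irrefl = begin
    ∑[ x < k ] ∑[ y < k ] 𝟙 (R x y)                ≤⟨ ∑-mono-≤ (λ x → ∑-mono-≤ (either-order x)) ⟩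
    ∑[ x < k ] ∑[ y < k ] (𝟙 (U x y) + 𝟙 (U y x))  ≡⟨ sum-cong-≗ (λ x → ∑-distrib-+ (U′ x) (λ y → U′ y x)) ⟩
    ∑[ x < k ] (∑[ y < k ] U′ x y + ∑[ y < k ] U′ y x)
                                                   ≡⟨ ∑-distrib-+ (λ x → ∑[ y < k ] U′ x y)
                                                                  (λ x → ∑[ y < k ] U′ y x) ⟩
    #U + ∑[ x < k ] ∑[ y < k ] U′ y x              ≡⟨ cong (#U +_) (∑-comm (λ x y → U′ y x)) ⟩
    #U + #U                                        ≡⟨ cong (#U +_) (+-identityʳ #U) ⟨
    2 * #U                                         ∎
    where
    open ≤-Reasoning
    U : Fin k → Fin k → Bool
    U p q = does (p <? q) ∧ (R p q ∨ R q p)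
    U′ : Fin k → Fin k → ℕ
    U′ p q = 𝟙 (U p q)
    #U = ∑[ p < k ] ∑[ q < k ] U′ p q
    either-order : ∀ x y → 𝟙 (R x y) ≤ U′ x y + U′ y x
    either-order x y = 𝟙≤ λ Rxy → case <-≢-cases (λ { refl → irrefl x Rxy }) of λ where
      (inj₁ x<y) → 1≤+ˡ (1≤𝟙 (T-∧ .from (⇒does (x <? y) x<y , T-∨ .from (inj₁ Rxy))))
      (inj₂ y<x) → 1≤+ʳ (1≤𝟙 (T-∧ .from (⇒does (y <? x) y<x , T-∨ .from (inj₂ Rxy))))

  module _ {k : ℕ} where

    Σ² : (Fin k → Fin k → ℕ) → ℕ
    Σ² g = ∑[ c < k ] ∑[ d < k ] g c d

    Σ³ : (Fin k → Fin k → Fin k → ℕ) → ℕ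
    Σ³ g = ∑[ b < k ] Σ² (g b)

    Σ⁴ : (Fin k → Fin k → Fin k → Fin k → ℕ) → ℕ
    Σ⁴ g = ∑[ a < k ] Σ³ (g a)

    Σ⁴-mono-≤ : ∀ {g h} → (∀ a b c d → g a b c d ≤ h a b c d) → Σ⁴ g ≤ Σ⁴ h
    Σ⁴-mono-≤ g≤h = ∑-mono-≤ λ a → ∑-mono-≤ λ b → ∑-mono-≤ λ c → ∑-mono-≤ λ d → g≤h a b c d

    Σ⁴-distrib-+ : ∀ g h → Σ⁴ (λ a b c d → g a b c d + h a b c d) ≡ Σ⁴ g + Σ⁴ h
    Σ⁴-distrib-+ g h =
      trans (sum-cong-≗ λ a →
        trans (sum-cong-≗ λ b →
          trans (sum-cong-≗ λ c → ∑-distrib-+ (g a b c) (h a b c))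
                (∑-distrib-+ (λ c → ∑[ d < k ] g a b c d) (λ c → ∑[ d < k ] h a b c d)))
              (∑-distrib-+ (Σ² ∘ g a) (Σ² ∘ h a)))
            (∑-distrib-+ (Σ³ ∘ g) (Σ³ ∘ h))

    Σ⁴-swap₁₂ : ∀ g → Σ⁴ (λ a b c d → g b a c d) ≡ Σ⁴ g
    Σ⁴-swap₁₂ g = ∑-comm (λ a b → Σ² (g b a))

    Σ⁴-swap₂₃ : ∀ g → Σ⁴ (λ a b c d → g a c b d) ≡ Σ⁴ g
    Σ⁴-swap₂₃ g = sum-cong-≗ λ a → ∑-comm (λ b c → ∑[ d < k ] g a c b d)

    Σ⁴-swap₃₄ : ∀ g → Σ⁴ (λ a b c d → g a b d c) ≡ Σ⁴ g
    Σ⁴-swap₃₄ g = sum-cong-≗ λ a → sum-cong-≗ λ b → ∑-comm (λ c d → g a b d c)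

    Σ⁴-rotate₃ : ∀ g → Σ⁴ (λ a b c d → g c a b d) ≡ Σ⁴ g
    Σ⁴-rotate₃ g = trans (Σ⁴-swap₂₃ (λ a b c d → g b a c d)) (Σ⁴-swap₁₂ g)

  Distinct : ∀ {k} → Fin k → Fin k → Fin k → Fin k → Set
  Distinct a b c d = a ≢ b × a ≢ c × a ≢ d × b ≢ c × b ≢ d × c ≢ d

  distinct? : ∀ {k} (a b c d : Fin k) → Dec (Distinct a b c d)
  distinct? a b c d =
    ¬? (a ≟ b) ×-dec ¬? (a ≟ c) ×-dec ¬? (a ≟ d) ×-dec ¬? (b ≟ c) ×-dec ¬? (b ≟ d) ×-dec ¬? (c ≟ d)

  -- Insertion sort: inserting the second, third and fourth coordinate into the sorted prefix has 2, 3
  -- and 4 possible outcomes, each reached by transpositions that keep F true.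
  module Sorting {k : ℕ} (F : Fin k → Fin k → Fin k → Fin k → Bool)
    (F-swap₁₂ : ∀ a b c d → T (F a b c d) → T (F b a c d))
    (F-swap₂₃ : ∀ a b c d → T (F a b c d) → T (F a c b d))
    (F-swap₃₄ : ∀ a b c d → T (F a b c d) → T (F a b d c)) where

    Admissible Sorted₂ Sorted₃ Sorted₄ : Fin k → Fin k → Fin k → Fin k → Set
    Admissible a b c d = Distinct a b c d × T (F a b c d)
    Sorted₂    a b c d = a < b × Admissible a b c d
    Sorted₃    a b c d = a < b × b < c × Admissible a b c d
    Sorted₄    a b c d = a < b × b < c × c < d × T (F a b c d)

    admissible? : ∀ a b c d → Dec (Admissible a b c d)
    admissible? a b c d = distinct? a b c d ×-dec T? (F a b c d)

    sorted₂? : ∀ a b c d → Dec (Sorted₂ a b c d)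
    sorted₂? a b c d = a <? b ×-dec admissible? a b c d

    sorted₃? : ∀ a b c d → Dec (Sorted₃ a b c d)
    sorted₃? a b c d = a <? b ×-dec b <? c ×-dec admissible? a b c d

    sorted₄? : ∀ a b c d → Dec (Sorted₄ a b c d)
    sorted₄? a b c d = a <? b ×-dec b <? c ×-dec c <? d ×-dec T? (F a b c d)

    swap₁₂ : ∀ {a b c d} → Admissible a b c d → Admissible b a c d
    swap₁₂ ((a≢b , a≢c , a≢d , b≢c , b≢d , c≢d) , f) =
      (≢-sym a≢b , b≢c , b≢d , a≢c , a≢d , c≢d) , F-swap₁₂ _ _ _ _ f

    swap₂₃ : ∀ {a b c d} → Admissible a b c d → Admissible a c b d
    swap₂₃ ((a≢b , a≢c , a≢d , b≢c , b≢d , c≢d) , f) =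
      (a≢c , a≢b , a≢d , ≢-sym b≢c , c≢d , b≢d) , F-swap₂₃ _ _ _ _ f

    swap₃₄ : ∀ {a b c d} → Admissible a b c d → Admissible a b d c
    swap₃₄ ((a≢b , a≢c , a≢d , b≢c , b≢d , c≢d) , f) =
      (a≢b , a≢d , a≢c , b≢d , b≢c , ≢-sym c≢d) , F-swap₃₄ _ _ _ _ f

    insert₂ : ∀ {a b c d} → Admissible a b c d → Sorted₂ a b c d ⊎ Sorted₂ b a c d
    insert₂ A@((a≢b , _) , _) with <-≢-cases a≢b
    ... | inj₁ a<b = inj₁ (a<b , A)
    ... | inj₂ b<a = inj₂ (b<a , swap₁₂ A)

    insert₃ : ∀ {a b c d} → Sorted₂ a b c d → Sorted₃ a b c d ⊎ Sorted₃ a c b d ⊎ Sorted₃ c a b d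
    insert₃ (a<b , A@((_ , a≢c , _ , b≢c , _) , _)) with <-≢-cases b≢c | <-≢-cases a≢c
    ... | inj₁ b<c | _        = inj₁ (a<b , b<c , A)
    ... | inj₂ c<b | inj₁ a<c = inj₂ (inj₁ (a<c , c<b , swap₂₃ A))
    ... | inj₂ c<b | inj₂ c<a = inj₂ (inj₂ (c<a , a<b , swap₁₂ (swap₂₃ A)))

    insert₄ : ∀ {a b c d} → Sorted₃ a b c d →
              Sorted₄ a b c d ⊎ Sorted₄ a b d c ⊎ Sorted₄ a d b c ⊎ Sorted₄ d a b c
    insert₄ (a<b , b<c , A@((_ , _ , a≢d , _ , b≢d , c≢d) , f))
      with <-≢-cases c≢d | <-≢-cases b≢d | <-≢-cases a≢d
    ... | inj₁ c<d | _        | _        = inj₁ (a<b , b<c , c<d , f)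
    ... | inj₂ d<c | inj₁ b<d | _        = inj₂ (inj₁ (a<b , b<d , d<c , proj₂ (swap₃₄ A)))
    ... | inj₂ d<c | inj₂ d<b | inj₁ a<d =
      inj₂ (inj₂ (inj₁ (a<d , d<b , b<c , proj₂ (swap₂₃ (swap₃₄ A)))))
    ... | inj₂ d<c | inj₂ d<b | inj₂ d<a =
      inj₂ (inj₂ (inj₂ (d<a , a<b , b<c , proj₂ (swap₁₂ (swap₂₃ (swap₃₄ A))))))

    module _ {R : Fin k → Fin k → Fin k → Fin k → Set} (R? : ∀ a b c d → Dec (R a b c d)) where

      𝟙[_] : Fin k → Fin k → Fin k → Fin k → ℕ
      𝟙[_] a b c d = 𝟙 (does (R? a b c d))

      #[_] : ℕ
      #[_] = Σ⁴ 𝟙[_]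

    #admissible≤2*#sorted₂ : #[ admissible? ] ≤ 2 * #[ sorted₂? ]
    #admissible≤2*#sorted₂ = begin
      #[ admissible? ]                          ≤⟨ Σ⁴-mono-≤ (λ a b c d →
        𝟙-⊎ (admissible? a b c d) (sorted₂? a b c d) (sorted₂? b a c d) insert₂) ⟩
      Σ⁴ (λ a b c d → s a b c d + s b a c d)    ≡⟨ Σ⁴-distrib-+ s _ ⟩
      #s + Σ⁴ (λ a b c d → s b a c d)           ≡⟨ cong (#s +_) (Σ⁴-swap₁₂ s) ⟩
      #s + #s                                   ≡⟨ cong (#s +_) (+-identityʳ #s) ⟨
      2 * #s                                    ∎
      where
      open ≤-Reasoning
      s = 𝟙[ sorted₂? ]
      #s = #[ sorted₂? ]

    #sorted₂≤3*#sorted₃ : #[ sorted₂? ] ≤ 3 * #[ sorted₃? ]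
    #sorted₂≤3*#sorted₃ = begin
      #[ sorted₂? ]                  ≤⟨ Σ⁴-mono-≤ (λ a b c d → 𝟙-⊎₃ (sorted₂? a b c d)
                                          (sorted₃? a b c d) (sorted₃? a c b d) (sorted₃? c a b d) insert₃) ⟩
      Σ⁴ (λ a b c d → s a b c d + (s₁ a b c d + s₂ a b c d))
                                     ≡⟨ Σ⁴-distrib-+ s _ ⟩
      #s + Σ⁴ (λ a b c d → s₁ a b c d + s₂ a b c d)
                                     ≡⟨ cong (#s +_) (Σ⁴-distrib-+ s₁ s₂) ⟩
      #s + (Σ⁴ s₁ + Σ⁴ s₂)           ≡⟨ cong (#s +_) (cong₂ _+_ (Σ⁴-swap₂₃ s) (Σ⁴-rotate₃ s)) ⟩
      #s + (#s + #s)                 ≡⟨ cong (λ x → #s + (#s + x)) (+-identityʳ #s) ⟨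
      3 * #s                         ∎
      where
      open ≤-Reasoning
      s s₁ s₂ : Fin k → Fin k → Fin k → Fin k → ℕ
      s = 𝟙[ sorted₃? ]
      s₁ a b c d = s a c b d
      s₂ a b c d = s c a b d
      #s = #[ sorted₃? ]

    #sorted₃≤4*#sorted₄ : #[ sorted₃? ] ≤ 4 * #[ sorted₄? ]
    #sorted₃≤4*#sorted₄ = begin
      #[ sorted₃? ]                  ≤⟨ Σ⁴-mono-≤ (λ a b c d → 𝟙-⊎₄ (sorted₃? a b c d)
                                          (sorted₄? a b c d) (sorted₄? a b d c)
                                          (sorted₄? a d b c) (sorted₄? d a b c) insert₄) ⟩
      Σ⁴ (λ a b c d → s a b c d + (s₁ a b c d + (s₂ a b c d + s₃ a b c d)))
                                     ≡⟨ Σ⁴-distrib-+ s _ ⟩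
      #s + Σ⁴ (λ a b c d → s₁ a b c d + (s₂ a b c d + s₃ a b c d))
                                     ≡⟨ cong (#s +_) (Σ⁴-distrib-+ s₁ _) ⟩
      #s + (Σ⁴ s₁ + Σ⁴ (λ a b c d → s₂ a b c d + s₃ a b c d))
                                     ≡⟨ cong (λ x → #s + (Σ⁴ s₁ + x)) (Σ⁴-distrib-+ s₂ s₃) ⟩
      #s + (Σ⁴ s₁ + (Σ⁴ s₂ + Σ⁴ s₃)) ≡⟨ cong (#s +_) (cong₂ _+_ (Σ⁴-swap₃₄ s) (cong₂ _+_
                                          (trans (Σ⁴-swap₃₄ (λ a b c d → s a c b d)) (Σ⁴-swap₂₃ s))
                                          (trans (Σ⁴-swap₃₄ (λ a b c d → s c a b d)) (Σ⁴-rotate₃ s)))) ⟩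
      #s + (#s + (#s + #s))          ≡⟨ cong (λ x → #s + (#s + (#s + x))) (+-identityʳ #s) ⟨
      4 * #s                         ∎
      where
      open ≤-Reasoning
      s s₁ s₂ s₃ : Fin k → Fin k → Fin k → Fin k → ℕ
      s = 𝟙[ sorted₄? ]
      s₁ a b c d = s a b d c
      s₂ a b c d = s a d b c
      s₃ a b c d = s d a b c
      #s = #[ sorted₄? ]

    #admissible≤24*#sorted : #[ admissible? ] ≤ 24 * #[ sorted₄? ]
    #admissible≤24*#sorted = begin
      #[ admissible? ]              ≤⟨ #admissible≤2*#sorted₂ ⟩
      2 * #[ sorted₂? ]             ≤⟨ *-monoʳ-≤ 2 #sorted₂≤3*#sorted₃ ⟩
      2 * (3 * #[ sorted₃? ])       ≤⟨ *-monoʳ-≤ 2 (*-monoʳ-≤ 3 #sorted₃≤4*#sorted₄) ⟩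
      2 * (3 * (4 * #[ sorted₄? ])) ≡⟨ *-assoc 2 3 (4 * #[ sorted₄? ]) ⟨
      6 * (4 * #[ sorted₄? ])       ≡⟨ *-assoc 6 4 #[ sorted₄? ] ⟨
      24 * #[ sorted₄? ]            ∎
      where open ≤-Reasoning

module Absorption where

  open Counting
  open import Defs
  open import Algebra.Bundles using (CommutativeMonoid)
  open import Data.Bool using (Bool; true; false; _∧_; _∨_; not; T)
  open import Data.Bool.Properties using (T?; T-∧; T-∨; ∨-comm; ∧-comm; ∨-commutativeMonoid)
  open import Algebra.Properties.CommutativeSemigroup
    (CommutativeMonoid.commutativeSemigroup ∨-commutativeMonoid) using (x∙yz≈y∙xz)
  open import Data.Empty using (⊥-elim)
  open import Data.Fin using (Fin; zero; suc; _≟_)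
  open import Data.Fin.Properties using (all?; ¬∀⟶∃¬; _<?_)
  open import Data.List using (List; []; _∷_; allFin; tabulate)
  open import Data.List.Membership.Propositional using (_∈_)
  open import Data.List.Relation.Unary.Any using (here; there)
  open import Data.Nat using (ℕ; zero; suc; _+_; _*_; _^_; _≤_; _<_; NonZero; >-nonZero⁻¹)
  open import Data.Nat.Properties hiding (_≟_; _<?_)
  open import Algebra.Properties.Semiring.Sum +-*-semiring
    using (sum-syntax; sum-cong-≗; ∑-comm; ∑-distrib-+)
  open import Data.Nat.Tactic.RingSolver using (solve-∀)
  open import Data.Product using (_×_; _,_; proj₁; proj₂)
  open import Data.Rational using (ℚ)
  open import Data.Sum using (inj₁; inj₂; [_,_])
  open import Function using (_∘_; id; case_of_)
  open import Function.Bundles using (Equivalence)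
  open import Relation.Binary.PropositionalEquality
    using (_≡_; _≢_; refl; sym; trans; cong; cong₂; subst; ≢-sym)
  open import Relation.Nullary using (¬_; Dec; yes; no; does; ¬?; _×-dec_; _⊎-dec_)
  open import Relation.Nullary.Decidable using (isYes≗does)
  open Equivalence using (to; from)

  sumL-tabulate : ∀ {A : Set} {k} (f : A → ℕ) (g : Fin k → A) → sumL f (tabulate g) ≡ ∑[ i < k ] f (g i)
  sumL-tabulate {k = zero}  f g = refl
  sumL-tabulate {k = suc k} f g = cong (f (g zero) +_) (sumL-tabulate f (g ∘ suc))

  sumL-allFin : ∀ {k} (f : Fin k → ℕ) → sumL f (allFin k) ≡ ∑[ i < k ] f i
  sumL-allFin f = sumL-tabulate f id

  countB≡sumL : ∀ {A : Set} (p : A → Bool) xs → countB p xs ≡ sumL (𝟙 ∘ p) xs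
  countB≡sumL p []       = refl
  countB≡sumL p (x ∷ xs) with p x
  ... | true  = cong suc (countB≡sumL p xs)
  ... | false = countB≡sumL p xs

  countB-allFin : ∀ {k} (p : Fin k → Bool) → countB p (allFin k) ≡ count p
  countB-allFin p = trans (countB≡sumL p (allFin _)) (sumL-allFin (𝟙 ∘ p))

  sumL²-allFin : ∀ {k} (P : Fin k → Fin k → Bool) →
    sumL (λ p → countB (P p) (allFin k)) (allFin k) ≡ ∑[ p < k ] count (P p)
  sumL²-allFin {k} P =
    trans (sumL-allFin (λ p → countB (P p) (allFin k))) (sum-cong-≗ λ p → countB-allFin (P p))

  sumL⁴-allFin : ∀ {k} (P : Fin k → Fin k → Fin k → Fin k → Bool) →
    sumL (λ w → sumL (λ x → sumL (λ y → countB (P w x y) (allFin k)) (allFin k)) (allFin k)) (allFin k) ≡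
    Σ⁴ (λ w x y z → 𝟙 (P w x y z))
  sumL⁴-allFin {k} P =
    trans (sumL-allFin (λ w → sumL (λ x → sumL (λ y → countB (P w x y) (allFin k)) (allFin k)) (allFin k)))
      (sum-cong-≗ λ w → trans (sumL-allFin (λ x → sumL (λ y → countB (P w x y) (allFin k)) (allFin k)))
        (sum-cong-≗ λ x → sumL²-allFin (P w x)))

  anyB-∈ : ∀ {A : Set} (p : A → Bool) {x xs} → x ∈ xs → T (p x) → T (anyB p xs)
  anyB-∈ p (here refl)  px = T-∨ .from (inj₁ px)
  anyB-∈ p (there x∈xs) px = T-∨ .from (inj₂ (anyB-∈ p x∈xs px))

  anyB-swap : ∀ {A : Set} (p : A → Bool) x y zs → anyB p (x ∷ y ∷ zs) ≡ anyB p (y ∷ x ∷ zs)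
  anyB-swap p x y zs = x∙yz≈y∙xz (p x) (p y) (anyB p zs)

  anyB-cong : ∀ {A : Set} {p q : A → Bool} → (∀ a → p a ≡ q a) → ∀ xs → anyB p xs ≡ anyB q xs
  anyB-cong p≗q []       = refl
  anyB-cong p≗q (x ∷ xs) = cong₂ _∨_ (p≗q x) (anyB-cong p≗q xs)

  anyB⁴-perm : ∀ {A : Set} (body : A → A → A → A → Bool) (L L′ : List A) → (∀ p → anyB p L′ ≡ anyB p L) →
    anyB (λ a → anyB (λ b → anyB (λ c → anyB (λ d → body a b c d) L′) L′) L′) L′ ≡
    anyB (λ a → anyB (λ b → anyB (λ c → anyB (λ d → body a b c d) L) L) L) L
  anyB⁴-perm body L L′ perm =
    trans (perm _) (anyB-cong (λ a → trans (perm _) (anyB-cong (λ b →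
      trans (perm _) (anyB-cong (λ c → perm _) L)) L)) L)

  +<-halves : ∀ {a b s} → 2 * a < s → 2 * b < s → a + b < s
  +<-halves {a} {b} {s} 2a<s 2b<s = *-cancelˡ-< 2 (a + b) s (begin-strict
    2 * (a + b)   ≡⟨ *-distribˡ-+ 2 a b ⟩
    2 * a + 2 * b <⟨ +-mono-< 2a<s 2b<s ⟩
    s + s         ≡⟨ cong (s +_) (+-identityʳ s) ⟨
    2 * s         ∎)
    where open ≤-Reasoning

  half-of-sum : ∀ {a b s} → a + b ≡ s → ¬ (s ≤ 2 * a) → s ≤ 2 * b
  half-of-sum {a} {b} {s} a+b≡s s≰2a with s ≤? 2 * b
  ... | yes s≤2b = s≤2b
  ... | no  s≰2b = ⊥-elim (<-irrefl a+b≡s (+<-halves {a} {b} (≰⇒> s≰2a) (≰⇒> s≰2b)))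

  half-degree-arith : ∀ {m n X} → n ≤ m * (2 * X) + m → 10 * m ≤ n → n + 2 * (4 * m) ≤ 4 * m * X
  half-degree-arith {m} {n} {X} n≤ 10m≤n = +-cancelʳ-≤ (2 * m) (n + 2 * (4 * m)) (4 * m * X) (begin
    n + 2 * (4 * m) + 2 * m                ≡⟨ e₁ n m ⟩
    n + 10 * m                             ≤⟨ +-monoʳ-≤ n 10m≤n ⟩
    n + n                                  ≤⟨ +-mono-≤ n≤ n≤ ⟩
    (m * (2 * X) + m) + (m * (2 * X) + m)  ≡⟨ e₂ m X ⟩
    4 * m * X + 2 * m                      ∎)
    where
    open ≤-Reasoning
    e₁ : ∀ n m → n + 2 * (4 * m) + 2 * m ≡ n + 10 * m
    e₁ = solve-∀
    e₂ : ∀ m X → (m * (2 * X) + m) + (m * (2 * X) + m) ≡ 4 * m * X + 2 * m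
    e₂ = solve-∀

  rich⇒many : ∀ {n q X Y} → n + 2 * q ≤ q * X → X ≤ Y + 2 → n ≤ q * Y
  rich⇒many {n} {q} {X} {Y} rich X≤Y+2 = +-cancelʳ-≤ (2 * q) n (q * Y) (begin
    n + 2 * q     ≤⟨ rich ⟩
    q * X         ≤⟨ *-monoʳ-≤ q X≤Y+2 ⟩
    q * (Y + 2)   ≡⟨ *-distribˡ-+ q Y 2 ⟩
    q * Y + q * 2 ≡⟨ cong (q * Y +_) (*-comm q 2) ⟩
    q * Y + 2 * q ∎)
    where open ≤-Reasoning

  codegree-arith : ∀ {m n a b c} → suc m * n ≤ 2 * (m * a) → suc m * n ≤ 2 * (m * b) →
                   a + b ≤ c + n → n ≤ m * c
  codegree-arith {m} {n} {a} {b} {c} ha hb a+b≤ = +-cancelʳ-≤ (m * n) n (m * c) (*-cancelˡ-≤ 2 (begin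
    2 * (suc m * n)            ≡⟨ cong (suc m * n +_) (+-identityʳ (suc m * n)) ⟩
    suc m * n + suc m * n      ≤⟨ +-mono-≤ ha hb ⟩
    2 * (m * a) + 2 * (m * b)  ≡⟨ e m a b ⟩
    2 * (m * (a + b))          ≤⟨ *-monoʳ-≤ 2 (*-monoʳ-≤ m a+b≤) ⟩
    2 * (m * (c + n))          ≡⟨ cong (2 *_) (*-distribˡ-+ m c n) ⟩
    2 * (m * c + m * n)        ∎))
    where
    open ≤-Reasoning
    e : ∀ m a b → 2 * (m * a) + 2 * (m * b) ≡ 2 * (m * (a + b))
    e = solve-∀

  high-split-arith : ∀ {m n h l d} → h + l ≡ d → suc m * n ≤ 2 * (m * d) → 4 * m * h < n → n ≤ 4 * m * l
  high-split-arith {m} {n} {h} {l} {d} h+l≡d hd 4mh<n = +-cancelˡ-≤ (4 * m * h) n (4 * m * l) (begin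
    4 * m * h + n            ≤⟨ +-monoˡ-≤ n (<⇒≤ 4mh<n) ⟩
    n + n                    ≤⟨ +-mono-≤ (m≤m+n n (m * n)) (m≤m+n n (m * n)) ⟩
    suc m * n + suc m * n    ≡⟨ cong (suc m * n +_) (+-identityʳ (suc m * n)) ⟨
    2 * (suc m * n)          ≤⟨ *-monoʳ-≤ 2 hd ⟩
    2 * (2 * (m * d))        ≡⟨ cong (λ x → 2 * (2 * (m * x))) h+l≡d ⟨
    2 * (2 * (m * (h + l)))  ≡⟨ e m h l ⟩
    4 * m * h + 4 * m * l    ∎)
    where
    open ≤-Reasoning
    e : ∀ m h l → 2 * (2 * (m * (h + l))) ≡ 4 * m * h + 4 * m * l
    e = solve-∀

  strong-high-arith : ∀ {m n h O} → n ≤ 4 * m * h → h * n ≤ m * O → n * n ≤ 32 * (m * m) * O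
  strong-high-arith {m} {n} {h} {O} n≤4mh hn≤mO = begin
    n * n             ≤⟨ *-monoˡ-≤ n n≤4mh ⟩
    4 * m * h * n     ≡⟨ *-assoc (4 * m) h n ⟩
    4 * m * (h * n)   ≤⟨ *-monoʳ-≤ (4 * m) hn≤mO ⟩
    4 * m * (m * O)   ≡⟨ e m O ⟩
    4 * (m * m) * O   ≤⟨ *-monoˡ-≤ O (*-monoˡ-≤ (m * m) (m≤m+n 4 28)) ⟩
    32 * (m * m) * O  ∎
    where
    open ≤-Reasoning
    e : ∀ m O → 4 * m * (m * O) ≡ 4 * (m * m) * O
    e = solve-∀

  strong-low-arith : ∀ {m n a b O} → 32 * (m * m) ≤ n → n ≤ 4 * m * a → n ≤ 4 * m * b →
                     a * b ≤ O + n → n * n ≤ 32 * (m * m) * O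
  strong-low-arith {m} {n} {a} {b} {O} large n≤4ma n≤4mb ab≤O+n =
    +-cancelʳ-≤ (n * n) (n * n) (32 * K * O) (begin
      n * n + n * n                                          ≤⟨ +-mono-≤ n²≤ n²≤ ⟩
      (16 * K * O + 16 * K * n) + (16 * K * O + 16 * K * n)  ≡⟨ e₂ K O n ⟩
      32 * K * O + 32 * K * n                                ≤⟨ +-monoʳ-≤ (32 * K * O) (*-monoˡ-≤ n large) ⟩
      32 * K * O + n * n                                     ∎)
    where
    open ≤-Reasoning
    K = m * m
    e₁ : ∀ m a b → (4 * m * a) * (4 * m * b) ≡ 16 * (m * m) * (a * b)
    e₁ = solve-∀
    e₂ : ∀ K O n → (16 * K * O + 16 * K * n) + (16 * K * O + 16 * K * n) ≡ 32 * K * O + 32 * K * n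
    e₂ = solve-∀
    n²≤ : n * n ≤ 16 * K * O + 16 * K * n
    n²≤ = begin
      n * n                      ≤⟨ *-mono-≤ n≤4ma n≤4mb ⟩
      (4 * m * a) * (4 * m * b)  ≡⟨ e₁ m a b ⟩
      16 * K * (a * b)           ≤⟨ *-monoʳ-≤ (16 * K) ab≤O+n ⟩
      16 * K * (O + n)           ≡⟨ *-distribˡ-+ (16 * K) O n ⟩
      16 * K * O + 16 * K * n    ∎

  module _ {n : ℕ} (G : OrientedGraph n) where

    adj-sym : ∀ x y → adj G x y ≡ adj G y x
    adj-sym x y = ∨-comm (E G x y) (E G y x)

    adj-flip : ∀ {x y} → T (adj G x y) → T (adj G y x)
    adj-flip {x} {y} = subst T (adj-sym x y)

    adj-irrefl : ∀ x → ¬ T (adj G x x)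
    adj-irrefl x rewrite loopless G x = λ ()

    adj⇒≢ : ∀ {x y} → T (adj G x y) → x ≢ y
    adj⇒≢ xy refl = adj-irrefl _ xy

    degIn : (Fin n → Bool) → Fin n → ℕ
    degIn C x = count (λ y → adj G x y ∧ C y)

    strongLabels : Fin n → Fin n → ℕ
    strongLabels u w = ∑[ x < n ] ∑[ y < n ] 𝟙 (strongLabel G u w x y)

    strongLabels-sym : ∀ u w → strongLabels u w ≡ strongLabels w u
    strongLabels-sym u w = trans (∑-comm (λ x y → 𝟙 (strongLabel G u w x y)))
      (sum-cong-≗ λ y → sum-cong-≗ λ x →
        cong 𝟙 (cong₂ _∧_ (adj-sym x y) (∧-comm (adj G x u) (adj G y w))))

    strongLabels≤2*numStrong : ∀ u w → strongLabels u w ≤ 2 * numStrong G u w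
    strongLabels≤2*numStrong u w = subst (strongLabels u w ≤_) (cong (2 *_) (sym (sumL²-allFin either)))
      (ordered≤2*unordered (strongLabel G u w) (λ x t → adj-irrefl x (proj₁ (T-∧ .to t))))
      where
      either : Fin n → Fin n → Bool
      either p q = does (p <? q) ∧ (strongLabel G u w p q ∨ strongLabel G u w q p)

    distinct4≡does : ∀ a b c d → distinct4 G a b c d ≡ does (distinct? a b c d)
    distinct4≡does a b c d rewrite isYes≗does (a ≟ b) | isYes≗does (a ≟ c) | isYes≗does (a ≟ d)
                                 | isYes≗does (b ≟ c) | isYes≗does (b ≟ d) | isYes≗does (c ≟ d) = refl

    module _ (α : ℚ) (u v : Fin n) where

      private
        W : Fin n → Fin n → Fin n → Fin n → Bool
        W = weakSet G α u v

        labelled : Fin n → Fin n → Fin n → Fin n → Bool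
        labelled a a′ b′ b = distinct4 G a a′ b′ b ∧ weakLabel G α u v a a′ b′ b

      weakSet-swap₁₂ : ∀ w x y z → T (W w x y z) → T (W x w y z)
      weakSet-swap₁₂ w x y z = subst T (sym (anyB⁴-perm labelled (w ∷ x ∷ y ∷ z ∷ []) (x ∷ w ∷ y ∷ z ∷ [])
        λ p → anyB-swap p x w (y ∷ z ∷ [])))

      weakSet-swap₂₃ : ∀ w x y z → T (W w x y z) → T (W w y x z)
      weakSet-swap₂₃ w x y z = subst T (sym (anyB⁴-perm labelled (w ∷ x ∷ y ∷ z ∷ []) (w ∷ y ∷ x ∷ z ∷ [])
        λ p → cong (p w ∨_) (anyB-swap p y x (z ∷ []))))

      weakSet-swap₃₄ : ∀ w x y z → T (W w x y z) → T (W w x z y)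
      weakSet-swap₃₄ w x y z = subst T (sym (anyB⁴-perm labelled (w ∷ x ∷ y ∷ z ∷ []) (w ∷ x ∷ z ∷ y ∷ [])
        λ p → cong (p w ∨_) (cong (p x ∨_) (anyB-swap p z y []))))

      weakSet-labelled : ∀ {a a′ b′ b} → T (labelled a a′ b′ b) → T (W a a′ b′ b)
      weakSet-labelled {a} {a′} {b′} {b} t =
        anyB-∈ (λ x → anyB (λ y → anyB (λ z → anyB (labelled x y z) L) L) L) {a} {L} (here refl)
          (anyB-∈ (λ y → anyB (λ z → anyB (labelled a y z) L) L) {a′} {L} (there (here refl))
            (anyB-∈ (λ z → anyB (labelled a a′ z) L) {b′} {L} (there (there (here refl)))
              (anyB-∈ (labelled a a′ b′) {b} {L} (there (there (there (here refl)))) t)))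
        where L = a ∷ a′ ∷ b′ ∷ b ∷ []

  -- n + 2q ≤ q·X says that X ≥ n/q + 2: after excluding two earlier vertices, n/q choices remain.
  module WeakAbsorberCount {n : ℕ} (G : OrientedGraph n) (α : ℚ) (v : Fin n) (C M : Fin n → Bool) (q : ℕ)
    (rich-v : n + 2 * q ≤ q * count (λ a → adj G v a ∧ M a))
    (rich-M : ∀ a → T (M a) → n + 2 * q ≤ q * degIn G C a)
    (strong : ∀ {a b a′ b′} → T (M a) → T (M b) → T (C a′) → T (C b′) → T (strongB G α a′ b′)) where

    Near : Fin n → Set
    Near a = T (adj G v a) × T (M a)

    Choice₂ : Fin n → Fin n → Set
    Choice₂ a a′ = Near a × T (adj G a a′) × T (C a′)

    Choice₃ : Fin n → Fin n → Fin n → Set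
    Choice₃ a a′ b = Choice₂ a a′ × Near b × b ≢ a × b ≢ a′

    Choice₄ : Fin n → Fin n → Fin n → Fin n → Set
    Choice₄ a a′ b b′ = Choice₃ a a′ b × T (adj G b b′) × T (C b′) × b′ ≢ a × b′ ≢ a′

    near? : ∀ a → Dec (Near a)
    near? a = T? (adj G v a) ×-dec T? (M a)

    choice₂? : ∀ a a′ → Dec (Choice₂ a a′)
    choice₂? a a′ = near? a ×-dec T? (adj G a a′) ×-dec T? (C a′)

    choice₃? : ∀ a a′ b → Dec (Choice₃ a a′ b)
    choice₃? a a′ b = choice₂? a a′ ×-dec near? b ×-dec ¬? (b ≟ a) ×-dec ¬? (b ≟ a′)

    choice₄? : ∀ a a′ b b′ → Dec (Choice₄ a a′ b b′)
    choice₄? a a′ b b′ =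
      choice₃? a a′ b ×-dec T? (adj G b b′) ×-dec T? (C b′) ×-dec ¬? (b′ ≟ a) ×-dec ¬? (b′ ≟ a′)

    many-choices : n ^ 4 ≤ q ^ 4 * Σ⁴ (λ a a′ b b′ → 𝟙 (does (choice₄? a a′ b b′)))
    many-choices = count-tree-≥ (does ∘ near?) (λ a → does ∘ choice₂? a) (λ a a′ → does ∘ choice₃? a a′)
                     (λ a a′ b → does ∘ choice₄? a a′ b) {q = q} many₁ many₂ many₃ many₄
      where
      many₁ : n ≤ q * count (does ∘ near?)
      many₁ = ≤-trans (m≤m+n n (2 * q)) rich-v

      many₂ : ∀ a → T (does (near? a)) → n ≤ q * count (does ∘ choice₂? a)
      many₂ a t = let near-a = does⇒ (near? a) t in begin
        n                              ≤⟨ m≤m+n n (2 * q) ⟩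
        n + 2 * q                      ≤⟨ rich-M a (proj₂ near-a) ⟩
        q * degIn G C a                ≤⟨ *-monoʳ-≤ q (count-mono λ a′ t′ →
                                            ⇒does (choice₂? a a′) (near-a , T-∧ .to t′)) ⟩
        q * count (does ∘ choice₂? a)  ∎
        where open ≤-Reasoning

      many₃ : ∀ a a′ → T (does (choice₂? a a′)) → n ≤ q * count (does ∘ choice₃? a a′)
      many₃ a a′ t = rich⇒many {q = q} rich-v (count-except₂ a a′ λ b near-b b≢a b≢a′ →
        ⇒does (choice₃? a a′ b) (does⇒ (choice₂? a a′) t , does⇒ (near? b) near-b , b≢a , b≢a′))

      many₄ : ∀ a a′ b → T (does (choice₃? a a′ b)) → n ≤ q * count (does ∘ choice₄? a a′ b)
      many₄ a a′ b t = let c₃@(_ , (_ , Mb) , _) = does⇒ (choice₃? a a′ b) t in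
        rich⇒many {q = q} (rich-M b Mb) (count-except₂ a a′ λ b′ t′ b′≢a b′≢a′ →
          let bb′ , Cb′ = T-∧ .to t′ in ⇒does (choice₄? a a′ b b′) (c₃ , bb′ , Cb′ , b′≢a , b′≢a′))

    open Sorting (weakSet G α v v) (weakSet-swap₁₂ G α v v) (weakSet-swap₂₃ G α v v) (weakSet-swap₃₄ G α v v)

    choice⇒admissible : ∀ {a a′ b b′} → Choice₄ a a′ b b′ → Admissible a a′ b′ b
    choice⇒admissible {a} {a′} {b} {b′}
      ((((va , Ma) , aa′ , Ca′) , (vb , Mb) , b≢a , b≢a′) , bb′ , Cb′ , b′≢a , b′≢a′) =
      distinct , weakSet-labelled G α v v {a} {a′} {b′} {b} (T-∧ .from (distinct4-true , labelled))
      where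
      distinct : Distinct a a′ b′ b
      distinct = adj⇒≢ G aa′ , ≢-sym b′≢a , ≢-sym b≢a , ≢-sym b′≢a′ , ≢-sym b≢a′ , ≢-sym (adj⇒≢ G bb′)
      distinct4-true : T (distinct4 G a a′ b′ b)
      distinct4-true = subst T (sym (distinct4≡does G a a′ b′ b)) (⇒does (distinct? a a′ b′ b) distinct)
      labelled : T (weakLabel G α v v a a′ b′ b)
      labelled = T-∧ .from (aa′ , T-∧ .from (adj-flip G va , T-∧ .from (vb , T-∧ .from (adj-flip G bb′ ,
                   strong Ma Mb Ca′ Cb′))))

    weakAbsorbers-≥ : n ^ 4 ≤ q ^ 4 * (24 * numWeak G α v v)
    weakAbsorbers-≥ = begin
      n ^ 4                          ≤⟨ many-choices ⟩
      q ^ 4 * Σ⁴ choices             ≡⟨ cong (q ^ 4 *_) (Σ⁴-swap₃₄ λ a a′ b′ b → choices a a′ b b′) ⟩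
      q ^ 4 * Σ⁴ (λ a a′ b′ b → choices a a′ b b′)
                                     ≤⟨ *-monoʳ-≤ (q ^ 4) (Σ⁴-mono-≤ λ a a′ b′ b → 𝟙-mono
                                          (⇒does (admissible? a a′ b′ b) ∘ choice⇒admissible
                                            ∘ does⇒ (choice₄? a a′ b b′))) ⟩
      q ^ 4 * #[ admissible? ]       ≤⟨ *-monoʳ-≤ (q ^ 4) #admissible≤24*#sorted ⟩
      q ^ 4 * (24 * #[ sorted₄? ])   ≡⟨ cong (λ x → q ^ 4 * (24 * x))
                                          (sumL⁴-allFin (λ w x y z → does (sorted₄? w x y z))) ⟨
      q ^ 4 * (24 * numWeak G α v v) ∎
      where
      open ≤-Reasoning
      choices : Fin n → Fin n → Fin n → Fin n → ℕ
      choices a a′ b b′ = 𝟙 (does (choice₄? a a′ b b′))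

  -- σ₂(G) ≥ (1 + 1/m) n, with the denominator cleared.
  OreCondition : ∀ {n} → OrientedGraph n → ℕ → Set
  OreCondition {n} G m =
    ∀ x y → x ≢ y → ¬ T (adj G x y) → suc m * n ≤ m * (count (adj G x) + count (adj G y))

  module Absorbers {n : ℕ} (G : OrientedGraph n) (m : ℕ) .{{_ : NonZero m}}
                   (ore : OreCondition G m) (large : 32 * (m * m) ≤ n) where

    d : Fin n → ℕ
    d x = count (adj G x)

    q : ℕ
    q = 4 * m

    degree-≥ : ∀ u → n ≤ m * d u + m
    degree-≥ u with all? (λ y → y ≟ u ⊎-dec T? (adj G u y))
    ... | yes u-sees-all = begin
      n                      ≡⟨ ∑-1 n ⟨
      count {n} (λ _ → true) ≤⟨ count-except {P = λ _ → true} {Q = adj G u} u (λ y _ y≢u →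
                                  [ (λ y≡u → ⊥-elim (y≢u y≡u)) , id ] (u-sees-all y)) ⟩
      suc (d u)              ≡⟨ +-comm 1 (d u) ⟩
      d u + 1                ≤⟨ +-mono-≤ (m≤n*m (d u) m) (>-nonZero⁻¹ m) ⟩
      m * d u + m            ∎
      where open ≤-Reasoning
    ... | no ¬u-sees-all = ≤-trans (+-cancelʳ-≤ (m * n) n (m * d u) (begin
      suc m * n          ≤⟨ ore u y (λ u≡y → y-unseen (inj₁ (sym u≡y))) (y-unseen ∘ inj₂) ⟩
      m * (d u + d y)    ≡⟨ *-distribˡ-+ m (d u) (d y) ⟩
      m * d u + m * d y  ≤⟨ +-monoʳ-≤ (m * d u) (*-monoʳ-≤ m (count≤ (adj G y))) ⟩
      m * d u + m * n    ∎)) (m≤m+n (m * d u) m)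
      where
      open ≤-Reasoning
      unseen = ¬∀⟶∃¬ n _ (λ y → y ≟ u ⊎-dec T? (adj G u y)) ¬u-sees-all
      y = proj₁ unseen
      y-unseen = proj₂ unseen

    High : Fin n → Set
    High x = suc m * n ≤ 2 * (m * d x)

    high : Fin n → Bool
    high x = does (suc m * n ≤? 2 * (m * d x))

    low : Fin n → Bool
    low x = not (high x)

    high⇒ : ∀ {x} → T (high x) → High x
    high⇒ {x} = does⇒ (suc m * n ≤? 2 * (m * d x))

    low⇒ : ∀ {x} → T (low x) → 2 * (m * d x) < suc m * n
    low⇒ {x} = ≰⇒> ∘ ¬does⇒ (suc m * n ≤? 2 * (m * d x))

    low-clique : ∀ {x y} → x ≢ y → T (low x) → T (low y) → T (adj G x y)
    low-clique {x} {y} x≢y lx ly with T? (adj G x y)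
    ... | yes xy = xy
    ... | no ¬xy = ⊥-elim (<⇒≱ (+<-halves {m * d x} {m * d y} (low⇒ lx) (low⇒ ly))
                            (subst (suc m * n ≤_) (*-distribˡ-+ m (d x) (d y)) (ore x y x≢y ¬xy)))

    count-low≤ : ∀ {x} → T (low x) → count low ≤ suc (degIn G low x)
    count-low≤ {x} lx = count-except x λ y ly y≢x → T-∧ .from (low-clique (≢-sym y≢x) lx ly , ly)

    strongLabels-via-high : ∀ u {w} → T (high w) → degIn G high u * n ≤ m * strongLabels G u w
    strongLabels-via-high u {w} hw =
      count*≤∑ (λ x → adj G u x ∧ high x) (count ∘ strongLabel G u w) {b = m} bound
      where
      bound : ∀ x → T (adj G u x ∧ high x) → n ≤ m * count (strongLabel G u w x)
      bound x t = let ux , hx = T-∧ .to t in begin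
        n                                        ≤⟨ codegree-arith {m} {n} {d x} {d w} (high⇒ hx) (high⇒ hw)
                                                      (count-∧-≥ (adj G x) (adj G w)) ⟩
        m * count (λ y → adj G x y ∧ adj G w y)  ≤⟨ *-monoʳ-≤ m (count-mono {Q = strongLabel G u w x} λ y t′ →
                                                      let xy , wy = T-∧ .to t′ in
                                                      T-∧ .from (xy , T-∧ .from (adj-flip G ux ,
                                                                                 adj-flip G wy))) ⟩
        m * count (strongLabel G u w x)          ∎
        where open ≤-Reasoning

    strongLabels-via-low : ∀ u w → degIn G low u * degIn G low w ≤ strongLabels G u w + n
    strongLabels-via-low u w = begin
      degIn G low u * degIn G low w      ≤⟨ count*≤∑ (λ x → adj G u x ∧ low x) f {b = 1} bound ⟩
      1 * ∑[ x < n ] f x                 ≡⟨ *-identityˡ _ ⟩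
      ∑[ x < n ] f x                     ≡⟨ ∑-distrib-+ (count ∘ strongLabel G u w) (λ _ → 1) ⟩
      strongLabels G u w + ∑[ x < n ] 1  ≡⟨ cong (strongLabels G u w +_) (∑-1 n) ⟩
      strongLabels G u w + n             ∎
      where
      open ≤-Reasoning
      f : Fin n → ℕ
      f x = count (strongLabel G u w x) + 1
      bound : ∀ x → T (adj G u x ∧ low x) → degIn G low w ≤ 1 * f x
      bound x t = let ux , lx = T-∧ .to t in begin
        degIn G low w                      ≤⟨ count-except x (λ y t′ y≢x → let wy , ly = T-∧ .to t′ in
                                                T-∧ .from (low-clique (≢-sym y≢x) lx ly ,
                                                           T-∧ .from (adj-flip G ux , adj-flip G wy))) ⟩
        suc (count (strongLabel G u w x))  ≡⟨ +-comm 1 _ ⟩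
        f x                                ≡⟨ *-identityˡ (f x) ⟨
        1 * f x                            ∎

    ManyStrongLabels : Fin n → Fin n → Set
    ManyStrongLabels u w = n * n ≤ 32 * (m * m) * strongLabels G u w

    manyStrong-via-low : ∀ {u w} → n ≤ q * degIn G low u → n ≤ q * degIn G low w → ManyStrongLabels u w
    manyStrong-via-low {u} {w} many-u many-w =
      strong-low-arith {m} {n} {degIn G low u} {degIn G low w} large many-u many-w (strongLabels-via-low u w)

    manyStrong-high : ∀ {u w} → T (high u) → T (high w) → ManyStrongLabels u w
    manyStrong-high {u} {w} hu hw with n ≤? q * degIn G high u | n ≤? q * degIn G high w
    ... | yes many-u | _          =
      strong-high-arith {m} {n} {degIn G high u} many-u (strongLabels-via-high u hw)
    ... | no _       | yes many-w = subst (λ s → n * n ≤ 32 * (m * m) * s) (strongLabels-sym G w u)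
      (strong-high-arith {m} {n} {degIn G high w} many-w (strongLabels-via-high w hu))
    ... | no few-u   | no few-w   = manyStrong-via-low
      (high-split-arith {m} {n} {degIn G high u} (count-∧-split (adj G u) high) (high⇒ hu) (≰⇒> few-u))
      (high-split-arith {m} {n} {degIn G high w} (count-∧-split (adj G w) high) (high⇒ hw) (≰⇒> few-w))

    mostlyHigh : Fin n → Bool
    mostlyHigh a = does (d a ≤? 2 * degIn G high a)

    half-degree-rich : ∀ a {X} → d a ≤ 2 * X → n + 2 * q ≤ q * X
    half-degree-rich a {X} da≤2X =
      half-degree-arith {m} {n} {X} (≤-trans (degree-≥ a) (+-monoˡ-≤ m (*-monoʳ-≤ m da≤2X))) 10m≤n
      where
      10m≤n : 10 * m ≤ n
      10m≤n = ≤-trans (*-monoˡ-≤ m (m≤m+n 10 22)) (≤-trans (*-monoʳ-≤ 32 (m≤m*n m m)) large)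

    mostlyHigh-rich : ∀ a → T (mostlyHigh a) → n + 2 * q ≤ q * degIn G high a
    mostlyHigh-rich a = half-degree-rich a ∘ does⇒ (d a ≤? 2 * degIn G high a)

    mostlyLow-rich : ∀ a → T (not (mostlyHigh a)) → n + 2 * q ≤ q * degIn G low a
    mostlyLow-rich a = half-degree-rich a ∘ half-of-sum {degIn G high a} (count-∧-split (adj G a) high)
                     ∘ ¬does⇒ (d a ≤? 2 * degIn G high a)

    many-low-neighbours : ∀ {a a′} → T (not (mostlyHigh a)) → T (low a′) → n ≤ q * degIn G low a′
    many-low-neighbours {a} {a′} Ma la′ = rich⇒many {q = q} (mostlyLow-rich a Ma) (begin
      degIn G low a          ≤⟨ count-mono {Q = low} (λ _ t → proj₂ (T-∧ .to t)) ⟩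
      count low              ≤⟨ count-low≤ la′ ⟩
      suc (degIn G low a′)   ≤⟨ n≤1+n _ ⟩
      2 + degIn G low a′     ≡⟨ +-comm 2 _ ⟩
      degIn G low a′ + 2     ∎)
      where open ≤-Reasoning

    manyStrong-low : ∀ {a a′ b b′} → T (not (mostlyHigh a)) → T (low a′) → T (not (mostlyHigh b)) → T (low b′) →
                     ManyStrongLabels a′ b′
    manyStrong-low Ma la′ Mb lb′ = manyStrong-via-low (many-low-neighbours Ma la′) (many-low-neighbours Mb lb′)

    manyStrong⇒numStrong : ∀ {u w} → ManyStrongLabels u w → n * n ≤ 64 * (m * m) * numStrong G u w
    manyStrong⇒numStrong {u} {w} many = begin
      n * n                                 ≤⟨ many ⟩
      32 * (m * m) * strongLabels G u w     ≤⟨ *-monoʳ-≤ (32 * (m * m)) (strongLabels≤2*numStrong G u w) ⟩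
      32 * (m * m) * (2 * numStrong G u w)  ≡⟨ e (m * m) (numStrong G u w) ⟩
      64 * (m * m) * numStrong G u w        ∎
      where
      open ≤-Reasoning
      e : ∀ K S → 32 * K * (2 * S) ≡ 64 * K * S
      e = solve-∀

    module _ (α : ℚ) (strong⇒ : ∀ {a′ b′} → ManyStrongLabels a′ b′ → T (strongB G α a′ b′)) (v : Fin n) where

      weakAbsorbers-via-high : d v ≤ 2 * count (λ a → adj G v a ∧ mostlyHigh a) →
                               n ^ 4 ≤ q ^ 4 * (24 * numWeak G α v v)
      weakAbsorbers-via-high mostly-high = WeakAbsorberCount.weakAbsorbers-≥ G α v high mostlyHigh q
        (half-degree-rich v mostly-high) mostlyHigh-rich
        (λ {_} {_} {a′} {b′} _ _ ha′ hb′ → strong⇒ {a′} {b′} (manyStrong-high ha′ hb′))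

      weakAbsorbers-via-low : ¬ (d v ≤ 2 * count (λ a → adj G v a ∧ mostlyHigh a)) →
                              n ^ 4 ≤ q ^ 4 * (24 * numWeak G α v v)
      weakAbsorbers-via-low ¬mostly-high = WeakAbsorberCount.weakAbsorbers-≥ G α v low (not ∘ mostlyHigh) q
        (half-degree-rich v (half-of-sum {count (λ a → adj G v a ∧ mostlyHigh a)}
                                         (count-∧-split (adj G v) mostlyHigh) ¬mostly-high))
        mostlyLow-rich
        (λ {a} {b} {a′} {b′} Ma Mb la′ lb′ → strong⇒ {a′} {b′} (manyStrong-low {a} {a′} {b} {b′} Ma la′ Mb lb′))

      -- `case` rather than `with`: abstracting over the goal would unfold numWeak, which is enormous.
      many-weakAbsorbers : n ^ 4 ≤ q ^ 4 * (24 * numWeak G α v v)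
      many-weakAbsorbers = case d v ≤? 2 * count (λ a → adj G v a ∧ mostlyHigh a) of λ where
        (yes mostly-high)  → weakAbsorbers-via-high mostly-high
        (no  ¬mostly-high) → weakAbsorbers-via-low ¬mostly-high

-- Imported only here, so that ℚ's _≤_ and _<_ do not clash with ℕ's in the modules above.
open import Defs
open import Data.Nat using (ℕ; zero; suc; z≤n; s≤s; _^_)
open import Data.Fin using (Fin)
open import Data.Product using (Σ; _×_; ∃-syntax; _,_)
open import Data.Sum using (_⊎_; inj₂)
open import Data.Rational using (ℚ; _<_; _≤_; 0ℚ; mkℚ; 1ℚ; _*_; _+_; ↧ₙ_; *≤*; *<*)
import Data.Nat as ℕ
open import Data.Nat.Coprimality using (1-coprimeTo) renaming (sym to coprime-sym)
open import Data.Nat.Properties using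
  (≤-trans; n≤1+n; *-assoc; *-identityˡ; *-identityʳ; *-comm; *-monoˡ-≤; *-monoʳ-≤; +-monoʳ-≤; module ≤-Reasoning)
open import Data.Nat.Tactic.RingSolver using (solve-∀)
open import Data.Integer as ℤ using (+_; -[1+_])
import Data.Integer.Properties as ℤ
import Data.Rational.Properties as ℚ
import Data.Rational.Unnormalised as ℚᵘ
import Data.Rational.Unnormalised.Properties as ℚᵘ
open import Data.Bool using (T)
open import Data.Bool.Properties using (T-∧)
open import Function using (_∘_)
open import Function.Bundles using (Equivalence)
open import Relation.Binary.PropositionalEquality using (_≡_; sym; cong; cong₂; subst; subst₂)
open import Relation.Nullary.Decidable using (fromWitnessFalse)
open Equivalence using (from)
open Counting
open Absorption

1/suc : ℕ → ℚ
1/suc k = mkℚ (+ 1) k (1-coprimeTo (suc k))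

1/suc-pos : ∀ k → 0ℚ < 1/suc k
1/suc-pos k = *<* (ℤ.+<+ (s≤s z≤n))

ℕ→ℚ≡mkℚ : ∀ k → ℕ→ℚ k ≡ mkℚ (+ k) 0 (coprime-sym (1-coprimeTo k))
ℕ→ℚ≡mkℚ k = ℚ.normalize-coprime (coprime-sym (1-coprimeTo k))

+*+-≤⇒ : ∀ a b c d → + a ℤ.* + b ℤ.≤ + c ℤ.* + d → a ℕ.* b ℕ.≤ c ℕ.* d
+*+-≤⇒ a b c d = ℤ.drop‿+≤+ ∘ subst₂ ℤ._≤_ (sym (ℤ.pos-* a b)) (sym (ℤ.pos-* c d))

⇒+*+-≤ : ∀ a b c d → a ℕ.* b ℕ.≤ c ℕ.* d → + a ℤ.* + b ℤ.≤ + c ℤ.* + d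
⇒+*+-≤ a b c d = subst₂ ℤ._≤_ (ℤ.pos-* a b) (ℤ.pos-* c d) ∘ ℤ.+≤+

*ℕ→ℚ-≤ : ∀ α {K N c} → 0ℚ < α → α ≤ 1/suc K → N ℕ.≤ suc K ℕ.* c → α * ℕ→ℚ N ≤ ℕ→ℚ c
*ℕ→ℚ-≤ α@(mkℚ (+ a) e _) {K} {N} {c} _ (*≤* α≤) N≤ rewrite ℕ→ℚ≡mkℚ N | ℕ→ℚ≡mkℚ c =
  ℚ.toℚᵘ-cancel-≤ (ℚᵘ.≤-respˡ-≃ (ℚᵘ.≃-sym (ℚ.toℚᵘ-homo-* α (mkℚ (+ N) 0 (coprime-sym (1-coprimeTo N)))))
    (ℚᵘ.*≤* (subst (λ x → x ℤ.* + 1 ℤ.≤ + c ℤ.* + suc (e ℕ.* 1)) (ℤ.pos-* a N)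
      (⇒+*+-≤ (a ℕ.* N) 1 c (suc (e ℕ.* 1)) (begin
        a ℕ.* N ℕ.* 1        ≡⟨ *-identityʳ (a ℕ.* N) ⟩
        a ℕ.* N              ≤⟨ *-monoʳ-≤ a N≤ ⟩
        a ℕ.* (suc K ℕ.* c)  ≡⟨ *-assoc a (suc K) c ⟨
        a ℕ.* suc K ℕ.* c    ≤⟨ *-monoˡ-≤ c (+*+-≤⇒ a (suc K) 1 (suc e) α≤) ⟩
        1 ℕ.* suc e ℕ.* c    ≡⟨ *-comm (1 ℕ.* suc e) c ⟩
        c ℕ.* (1 ℕ.* suc e)  ≡⟨ cong (c ℕ.*_) (*-identityˡ (suc e)) ⟩
        c ℕ.* suc e          ≡⟨ cong (λ x → c ℕ.* suc x) (*-identityʳ e) ⟨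
        c ℕ.* suc (e ℕ.* 1)  ∎)))))
  where open ≤-Reasoning
*ℕ→ℚ-≤ (mkℚ -[1+ _ ] _ _) (*<* ()) _ _

-- In ℚᵘ, (1 + p/(e+1)) · n/1 is literally (n + (e + p) n)/(e + 1): no normalisation takes place.
σ₂⇒ore : ∀ η {n s} → 0ℚ < η → (1ℚ + η) * ℕ→ℚ n ≤ ℕ→ℚ s → suc (↧ₙ η) ℕ.* n ℕ.≤ ↧ₙ η ℕ.* s
σ₂⇒ore η@(mkℚ (+ suc p) e _) {n} {s} _ h rewrite ℕ→ℚ≡mkℚ n | ℕ→ℚ≡mkℚ s
  with ℚᵘ.≤-respˡ-≃ (ℚᵘ.≃-trans (ℚ.toℚᵘ-homo-* (1ℚ + η) (mkℚ (+ n) 0 (coprime-sym (1-coprimeTo n))))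
                                 (ℚᵘ.*-congʳ (ℚ.toℚᵘ-homo-+ 1ℚ η)))
                    (ℚ.toℚᵘ-mono-≤ h)
... | ℚᵘ.*≤* cross = begin
  (2 ℕ.+ e) ℕ.* n                ≡⟨ e₁ e n ⟩
  n ℕ.+ (e ℕ.+ 0 ℕ.+ 1) ℕ.* n    ≤⟨ +-monoʳ-≤ n (*-monoˡ-≤ n (+-monoʳ-≤ (e ℕ.+ 0) (s≤s z≤n))) ⟩
  X                              ≡⟨ *-identityʳ X ⟨
  X ℕ.* 1                        ≤⟨ +*+-≤⇒ X 1 s (suc ((e ℕ.+ 0) ℕ.* 1))
                                      (subst (λ x → x ℤ.* + 1 ℤ.≤ + s ℤ.* + suc ((e ℕ.+ 0) ℕ.* 1))
                                             (ℤ.+◃n≡+n X) cross) ⟩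
  s ℕ.* (1 ℕ.+ (e ℕ.+ 0) ℕ.* 1)  ≡⟨ e₂ e s ⟩
  (1 ℕ.+ e) ℕ.* s                ∎
  where
  open ≤-Reasoning
  X = n ℕ.+ (e ℕ.+ 0 ℕ.+ suc (p ℕ.* 1)) ℕ.* n
  e₁ : ∀ e n → (2 ℕ.+ e) ℕ.* n ≡ n ℕ.+ (e ℕ.+ 0 ℕ.+ 1) ℕ.* n
  e₁ = solve-∀
  e₂ : ∀ e s → s ℕ.* (1 ℕ.+ (e ℕ.+ 0) ℕ.* 1) ≡ (1 ℕ.+ e) ℕ.* s
  e₂ = solve-∀
σ₂⇒ore (mkℚ (+ zero) _ _) (*<* (ℤ.+<+ ())) _
σ₂⇒ore (mkℚ -[1+ _ ] _ _) (*<* ()) _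

module _ {η : ℚ} (η>0 : 0ℚ < η) {n : ℕ} (G : OrientedGraph n) (σ₂ : Sigma2Geq G η) where

  Sigma2Geq⇒OreCondition : OreCondition G (↧ₙ η)
  Sigma2Geq⇒OreCondition x y x≢y ¬xy =
    subst (λ s → suc (↧ₙ η) ℕ.* n ℕ.≤ ↧ₙ η ℕ.* s)
          (cong₂ ℕ._+_ (countB-allFin (adj G x)) (countB-allFin (adj G y)))
      (σ₂⇒ore η {n} {deg G x ℕ.+ deg G y} η>0 (σ₂ x y (T-∧ .from (fromWitnessFalse x≢y , ¬T⇒T-not ¬xy))))

  every-vertex-weakly-absorbable : ∀ {α₁ α₂} → 0ℚ < α₁ → α₁ ≤ 1/suc (64 ℕ.* (↧ₙ η ℕ.* ↧ₙ η)) →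
    0ℚ < α₂ → α₂ ≤ 1/suc ((4 ℕ.* ↧ₙ η) ^ 4 ℕ.* 24) → 32 ℕ.* (↧ₙ η ℕ.* ↧ₙ η) ℕ.≤ n →
    ∀ v → WeaklyAbsorbable G α₂ α₁ v
  every-vertex-weakly-absorbable {α₁} {α₂} α₁>0 α₁≤ α₂>0 α₂≤ large v =
    *ℕ→ℚ-≤ α₂ {q ^ 4 ℕ.* 24} {n ℕ.* n ℕ.* n ℕ.* n} {W} α₂>0 α₂≤ (begin
      n ℕ.* n ℕ.* n ℕ.* n       ≡⟨ n⁴ n ⟩
      n ^ 4                     ≤⟨ many-weakAbsorbers α₁ strong⇒ v ⟩
      q ^ 4 ℕ.* (24 ℕ.* W)      ≡⟨ *-assoc (q ^ 4) 24 W ⟨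
      q ^ 4 ℕ.* 24 ℕ.* W        ≤⟨ *-monoˡ-≤ W (n≤1+n (q ^ 4 ℕ.* 24)) ⟩
      suc (q ^ 4 ℕ.* 24) ℕ.* W  ∎)
    where
    open ≤-Reasoning
    open Absorbers G (↧ₙ η) Sigma2Geq⇒OreCondition large
    W = numWeak G α₁ v v
    strong⇒ : ∀ {a′ b′} → ManyStrongLabels a′ b′ → T (strongB G α₁ a′ b′)
    strong⇒ {a′} {b′} many = ℚ.≤⇒≤ᵇ (*ℕ→ℚ-≤ α₁ {64 ℕ.* (↧ₙ η ℕ.* ↧ₙ η)} {n ℕ.* n} {numStrong G a′ b′} α₁>0 α₁≤
      (≤-trans (manyStrong⇒numStrong many) (*-monoˡ-≤ (numStrong G a′ b′) (n≤1+n (64 ℕ.* (↧ₙ η ℕ.* ↧ₙ η))))))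
    n⁴ : ∀ x → x ℕ.* x ℕ.* x ℕ.* x ≡ x ℕ.* (x ℕ.* (x ℕ.* (x ℕ.* 1)))
    n⁴ = solve-∀

-- Any η₀ would do: the argument works for every η > 0.
lemma4p6 : ∃[ η₀ ] (0ℚ < η₀ × (∀ η → 0ℚ < η → η ≤ η₀ →
    ∃[ α₁₀ ] (0ℚ < α₁₀ × (∀ α₁ → 0ℚ < α₁ → α₁ ≤ α₁₀ →
    ∃[ α₂₀ ] (0ℚ < α₂₀ × (∀ α₂ → 0ℚ < α₂ → α₂ ≤ α₂₀ →
    ∃[ n₀ ] (∀ (n : ℕ) → n₀ Data.Nat.≤ n →
    ∀ (G : OrientedGraph n) → Sigma2Geq G η →
    ∀ (v : Fin n) →
    StronglyAbsorbable G α₁ v ⊎ WeaklyAbsorbable G α₂ α₁ v)))))))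
lemma4p6 = 1/suc 0 , 1/suc-pos 0 , λ η η>0 _ →
  let m = ↧ₙ η in
  1/suc (64 ℕ.* (m ℕ.* m)) , 1/suc-pos _ , λ α₁ α₁>0 α₁≤ →
  1/suc ((4 ℕ.* m) ^ 4 ℕ.* 24) , 1/suc-pos _ , λ α₂ α₂>0 α₂≤ →
  32 ℕ.* (m ℕ.* m) , λ n large G σ₂ v →
  inj₂ (every-vertex-weakly-absorbable η>0 G σ₂ α₁>0 α₁≤ α₂>0 α₂≤ large v)
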